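{- Let $n,k\in\mathbb{N}$ with $n\ge3$, $k\ge2$. Then $\sigma^{\boxtimes}_V(MC_n^k)\le\left\lfloor\frac{n}{2}\right\rfloor+1$ and $\sigma^{\times}_V(MC_n^k)\le\left\lfloor\frac{n}{2}\right\rfloor+1$.
   Context: For $n\ge3$, $k\ge2$, the multilayered cycle $MC_n^k$ is the graph with vertex set $\{(i,j): i\in\mathbb{Z}_n,\ j\in\{1,\dots,k\}\}$ in which $(a,b)$ and $(c,d)$ are adjacent iff either $a=c$ and $|d-b|=1$, or $b=d$ and $a-c\equiv\pm1 \pmod n$. Write $\mathbb{N}_l=\{1,\dots,l\}$ and let $d$ denote the shortest-path distance in the graph. For a graph $G$ and $l\in\mathbb{N}$: an $l$-track is a surjective map $f:\mathbb{N}_l\to V(G)$ with $f(i)f(i+1)\in E(G)$ for all $i\in\mathbb{N}_{l-1}$; a lazy $l$-track is a surjective map $f:\mathbb{N}_l\to V(G)$ with $f(i)f(i+1)\in E(G)$ or $f(i)=f(i+1)$ for all $i\in\mathbb{N}_{l-1}$. For maps $f,g:\mathbb{N}_l\to V(G)$ set $m_G(f,g)=\min\{d(f(i),g(i)): i\in\mathbb{N}_l\}$. The strong vertex span $\sigma^{\boxtimes}_V(G)$ is the maximum of $m_G(f,g)$ over all $l\in\mathbb{N}$ and all pairs $f,g$ of lazy $l$-tracks on $G$. The direct vertex span $\sigma^{\times}_V(G)$ is the maximum of $m_G(f,g)$ over all $l\in\mathbb{N}$ and all pairs $f,g$ of $l$-tracks on $G$. -}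

module Defs where

open import Data.Nat using (ℕ; zero; suc; _≤_)
open import Data.Fin using (Fin; toℕ)
open import Data.Product using (Σ; ∃; _×_; _,_)
open import Data.Sum using (_⊎_)
open import Relation.Binary.PropositionalEquality using (_≡_)
open import Function.Definitions using (Surjective)

record Graph : Set₁ where
  field
    V   : Set
    Adj : V → V → Set
open Graph public

data Walk (G : Graph) : V G → V G → ℕ → Set where
  here : ∀ {u} → Walk G u u 0
  step : ∀ {u v w m} → Adj G u v → Walk G v w m → Walk G u w (suc m)

IsDist : (G : Graph) → V G → V G → ℕ → Set
IsDist G u v m = Walk G u v m × (∀ m' → Walk G u v m' → m ≤ m')

-- One step around the cycle Z_n (vertices 0..n-1): a ≡ c + 1 (mod n).
CycSucc : ∀ {n} → Fin n → Fin n → Set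
CycSucc {n} c a = (suc (toℕ c) ≡ toℕ a) ⊎ ((suc (toℕ c) ≡ n) × (toℕ a ≡ 0))

-- Multilayered cycle MC_n^k. Vertex (i , j) with i : Fin n = Z_n and
-- j : Fin k representing layer j+1 ∈ {1,…,k}.
MC : ℕ → ℕ → Graph
MC n k = record
  { V   = Fin n × Fin k
  ; Adj = λ { (a , b) (c , d) →
        ((a ≡ c) × ((toℕ d ≡ suc (toℕ b)) ⊎ (toℕ b ≡ suc (toℕ d))))
      ⊎ ((b ≡ d) × (CycSucc c a ⊎ CycSucc a c)) }
  }

-- N_l = {1,…,l} is represented by Fin l (position i+1 ↦ i).
-- l-track: surjective, consecutive values adjacent.
IsTrack : (G : Graph) (l : ℕ) → (Fin l → V G) → Set
IsTrack G l f =
  Surjective _≡_ _≡_ f ×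
  (∀ (i j : Fin l) → toℕ j ≡ suc (toℕ i) → Adj G (f i) (f j))

IsLazyTrack : (G : Graph) (l : ℕ) → (Fin l → V G) → Set
IsLazyTrack G l f =
  Surjective _≡_ _≡_ f ×
  (∀ (i j : Fin l) → toℕ j ≡ suc (toℕ i) → Adj G (f i) (f j) ⊎ f i ≡ f j)

IsMinDist : (G : Graph) (l : ℕ) → (Fin l → V G) → (Fin l → V G) → ℕ → Set
IsMinDist G l f g m =
  (∃ λ i → IsDist G (f i) (g i) m) ×
  (∀ i d → IsDist G (f i) (g i) d → m ≤ d)

-- "σ^⊠_V(G) ≤ B": every value m_G(f,g) over pairs of lazy tracks is ≤ B.
StrongVertexSpan≤ : Graph → ℕ → Set
StrongVertexSpan≤ G B =
  ∀ l (f g : Fin l → V G) → IsLazyTrack G l f → IsLazyTrack G l g →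
  ∀ m → IsMinDist G l f g m → m ≤ B

-- "σ^×_V(G) ≤ B": every value m_G(f,g) over pairs of tracks is ≤ B.
DirectVertexSpan≤ : Graph → ℕ → Set
DirectVertexSpan≤ G B =
  ∀ l (f g : Fin l → V G) → IsTrack G l f → IsTrack G l g →
  ∀ m → IsMinDist G l f g m → m ≤ B

-- Project both tracks onto the layer coordinate. Each lazy track moves at most one
-- layer per step, and f visits both the bottom and the top layer, so the layer of f
-- starts below that of g and ends above it; a discrete intermediate value argument
-- gives a time j at which the two layers differ by at most one. Inside a layer the
-- cycle Z_n has diameter ⌊n/2⌋, so d(f j, g j) ≤ ⌊n/2⌋ + 1.
module Submission where

open import Defs
import Data.Nat as ℕ
open import Data.Nat using (ℕ; zero; suc; _+_; _*_; _∸_; _≤_; _<_; z≤n; s≤s; _≤?_)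
open import Data.Nat.Properties
open import Data.Nat.DivMod using (_/_; _%_; m≡m%n+[m/n]*n; m%n<n)
open import Data.Fin using (Fin; toℕ; fromℕ; fromℕ<)
import Data.Fin as Fin
open import Data.Fin.Properties using (toℕ-injective; toℕ<n; toℕ-fromℕ<; toℕ-fromℕ; any?)
open import Data.Product using (∃; _×_; _,_; proj₁; proj₂)
open import Data.Product.Properties using (≡-dec)
open import Data.Sum using (_⊎_; inj₁; inj₂)
open import Relation.Binary using (Decidable; DecidableEquality; Symmetric; tri<; tri≈; tri>)
open import Relation.Binary.PropositionalEquality
open import Function using (_∘_)
open import Function.Consequences using (surjective⇒strictlySurjective)
open import Relation.Nullary using (Dec; yes; no; ¬_; contradiction)
open import Relation.Nullary.Decidable using (map′; _×-dec_; _⊎-dec_)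
import Relation.Unary as U

least-witness : {P : ℕ → Set} → U.Decidable P → ∀ {w} → P w →
  ∃ λ d → P d × (∀ m → P m → d ≤ m)
least-witness P? {zero} Pw = 0 , Pw , λ _ _ → z≤n
least-witness P? {suc w} Pw with P? 0
... | yes P0 = 0 , P0 , λ _ _ → z≤n
... | no ¬P0 with least-witness (λ m → P? (suc m)) Pw
...   | d , Pd , least = suc d , Pd , λ { zero P0 → contradiction P0 ¬P0
                                        ; (suc m) Pm → s≤s (least m Pm) }

n≤1+n/2+n/2 : ∀ n → n ≤ suc (n / 2 + n / 2)
n≤1+n/2+n/2 n = begin
  n                         ≡⟨ m≡m%n+[m/n]*n n 2 ⟩
  n % 2 + n / 2 * 2         ≤⟨ +-monoˡ-≤ (n / 2 * 2) (<⇒≤pred (m%n<n n 2)) ⟩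
  suc (n / 2 * 2)           ≡⟨ cong suc (*-comm (n / 2) 2) ⟩
  suc (n / 2 + (n / 2 + 0)) ≡⟨ cong (λ x → suc (n / 2 + x)) (+-identityʳ (n / 2)) ⟩
  suc (n / 2 + n / 2)       ∎
  where open ≤-Reasoning

split-at-half : ∀ {x y n} → x + y ≡ n → x ≤ n / 2 ⊎ y ≤ n / 2
split-at-half {x} {y} {n} x+y≡n with x ≤? n / 2
... | yes x≤n/2 = inj₁ x≤n/2
... | no  x≰n/2 = inj₂ (+-cancelˡ-≤ (suc (n / 2)) y (n / 2) (begin
  suc (n / 2) + y   ≤⟨ +-monoˡ-≤ y (≰⇒> x≰n/2) ⟩
  x + y             ≡⟨ x+y≡n ⟩
  n                 ≤⟨ n≤1+n/2+n/2 n ⟩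
  suc (n / 2) + n / 2 ∎))
  where open ≤-Reasoning

descent+detour≡1+N : ∀ {a c N} → c ≤ a → a ≤ N → (a ∸ c) + (c + suc (N ∸ a)) ≡ suc N
descent+detour≡1+N {a} {c} {N} c≤a a≤N = begin
  (a ∸ c) + (c + suc (N ∸ a)) ≡⟨ +-assoc (a ∸ c) c _ ⟨
  (a ∸ c + c) + suc (N ∸ a)   ≡⟨ cong (_+ suc (N ∸ a)) (m∸n+n≡m c≤a) ⟩
  a + suc (N ∸ a)             ≡⟨ +-suc a (N ∸ a) ⟩
  suc (a + (N ∸ a))           ≡⟨ cong suc (m+[n∸m]≡n a≤N) ⟩
  suc N                       ∎
  where open ≡-Reasoning

WithinOne : ℕ → ℕ → Set
WithinOne x y = x ≤ suc y × y ≤ suc x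

WithinOne-sym : ∀ {x y} → WithinOne x y → WithinOne y x
WithinOne-sym (x≤1+y , y≤1+x) = y≤1+x , x≤1+y

≡⇒WithinOne : ∀ {x y} → x ≡ y → WithinOne x y
≡⇒WithinOne refl = n≤1+n _ , n≤1+n _

≡suc⇒WithinOne : ∀ {x y} → y ≡ suc x → WithinOne x y
≡suc⇒WithinOne refl = m≤n⇒m≤1+n (n≤1+n _) , ≤-refl

WithinOne-cases : ∀ {x y} → WithinOne x y → x ≡ y ⊎ (y ≡ suc x ⊎ x ≡ suc y)
WithinOne-cases {x} {y} (x≤1+y , y≤1+x) with <-cmp x y
... | tri< x<y _ _ = inj₂ (inj₁ (≤-antisym y≤1+x x<y))
... | tri≈ _ x≡y _ = inj₁ x≡y
... | tri> _ _ y<x = inj₂ (inj₂ (≤-antisym x≤1+y y<x))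

module _ {l : ℕ} where

  Consecutive : Fin l → Fin l → Set
  Consecutive i j = toℕ j ≡ suc (toℕ i)

  discrete-ivt : {A B : Fin l → Set} → U.Decidable B →
    (∀ {i j} → Consecutive i j → A i → ¬ B i → A j) →
    ∀ {i t} → toℕ i ≤ toℕ t → A i → B t → ∃ λ j → A j × B j
  discrete-ivt {A} {B} B? A-step i≤t = go _ (sym (m∸n+n≡m i≤t))
    where
    go : ∀ d {i t} → toℕ t ≡ d + toℕ i → A i → B t → ∃ λ j → A j × B j
    go zero    t≡i   Ai Bt = _ , Ai , subst B (toℕ-injective t≡i) Bt
    go (suc d) {i} {t} t≡1+d+i Ai Bt with B? i
    ... | yes Bi = i , Ai , Bi
    ... | no ¬Bi = go d t≡d+i′ (A-step (toℕ-fromℕ< i′<l) Ai ¬Bi) Bt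
      where
      t≡d+1+i : toℕ t ≡ d + suc (toℕ i)
      t≡d+1+i = trans t≡1+d+i (sym (+-suc d (toℕ i)))
      i′<l : suc (toℕ i) < l
      i′<l = ≤-<-trans (subst (suc (toℕ i) ≤_) (sym t≡d+1+i) (m≤n+m _ d)) (toℕ<n t)
      t≡d+i′ : toℕ t ≡ d + toℕ (fromℕ< i′<l)
      t≡d+i′ = trans t≡d+1+i (cong (d +_) (sym (toℕ-fromℕ< i′<l)))

  OneStep : (Fin l → ℕ) → Set
  OneStep P = ∀ {i j} → Consecutive i j → WithinOne (P i) (P j)

  crossing-forward : ∀ {P Q : Fin l → ℕ} → OneStep P → OneStep Q →
    ∀ {i t} → toℕ i ≤ toℕ t → P i ≤ Q i → Q t ≤ P t → ∃ λ j → WithinOne (P j) (Q j)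
  crossing-forward {P} {Q} P-step Q-step i≤t Pi≤Qi Qt≤Pt =
    discrete-ivt (λ j → Q j ≤? suc (P j)) below-persists i≤t
      (m≤n⇒m≤1+n Pi≤Qi) (m≤n⇒m≤1+n Qt≤Pt)
    where
    -- Q i ≥ P i + 2 and each side moves by at most one, so P j ≤ Q j.
    below-persists : ∀ {i j} → Consecutive i j → P i ≤ suc (Q i) → ¬ Q i ≤ suc (P i) →
                     P j ≤ suc (Q j)
    below-persists i→j _ Qi≰1+Pi = m≤n⇒m≤1+n (≤-trans (proj₂ (P-step i→j))
      (≤-pred (≤-trans (≰⇒> Qi≰1+Pi) (proj₁ (Q-step i→j)))))

  crossing : ∀ {P Q : Fin l → ℕ} → OneStep P → OneStep Q →
    ∀ {i t} → P i ≤ Q i → Q t ≤ P t → ∃ λ j → WithinOne (P j) (Q j)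
  crossing P-step Q-step {i} {t} Pi≤Qi Qt≤Pt with ≤-total (toℕ i) (toℕ t)
  ... | inj₁ i≤t = crossing-forward P-step Q-step i≤t Pi≤Qi Qt≤Pt
  ... | inj₂ t≤i with crossing-forward Q-step P-step t≤i Qt≤Pt Pi≤Qi
  ...   | j , near = j , WithinOne-sym near

module _ {G : Graph} where

  _++ᵂ_ : ∀ {u v w a b} → Walk G u v a → Walk G v w b → Walk G u w (a + b)
  here       ++ᵂ W′ = W′
  step e W   ++ᵂ W′ = step e (W ++ᵂ W′)

  reverse : Symmetric (Adj G) → ∀ {u v m} → Walk G u v m → Walk G v u m
  reverse sym-adj here             = here
  reverse sym-adj (step {m = m} e W) =
    subst (Walk G _ _) (+-comm m 1) (reverse sym-adj W ++ᵂ step (sym-adj e) here)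

  track⇒lazyTrack : ∀ {l f} → IsTrack G l f → IsLazyTrack G l f
  track⇒lazyTrack (onto , steps) = onto , λ i j i→j → inj₁ (steps i j i→j)

strong⇒direct : ∀ {G B} → StrongVertexSpan≤ G B → DirectVertexSpan≤ G B
strong⇒direct {G} strong l f g f-track g-track =
  strong l f g (track⇒lazyTrack {G} f-track) (track⇒lazyTrack {G} g-track)

module Distance (G : Graph) (_≟_ : DecidableEquality (V G)) (adj? : Decidable (Adj G))
                (∃? : {P : V G → Set} → U.Decidable P → Dec (∃ P)) where

  walk? : ∀ m u v → Dec (Walk G u v m)
  walk? zero    u v = map′ (λ { refl → here }) (λ { here → refl }) (u ≟ v)
  walk? (suc m) u v = map′ (λ (_ , e , W) → step e W) (λ { (step e W) → _ , e , W })
                           (∃? λ x → adj? u x ×-dec walk? m x v)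

  walk⇒dist : ∀ {u v w} → Walk G u v w → ∃ λ d → IsDist G u v d × d ≤ w
  walk⇒dist {u} {v} W with least-witness (λ m → walk? m u v) W
  ... | d , Wd , least = d , (Wd , least) , least _ W

  minDist≤length : ∀ {l f g m} → IsMinDist G l f g m →
                   ∀ {j w} → Walk G (f j) (g j) w → m ≤ w
  minDist≤length (_ , minimal) W with walk⇒dist W
  ... | d , dist , d≤w = ≤-trans (minimal _ d dist) d≤w

module _ {n k : ℕ} where

  cycSucc? : Decidable (CycSucc {n})
  cycSucc? c a = (suc (toℕ c) ℕ.≟ toℕ a) ⊎-dec ((suc (toℕ c) ℕ.≟ n) ×-dec (toℕ a ℕ.≟ 0))

  mc-adj? : Decidable (Adj (MC n k))
  mc-adj? (a , b) (c , d) =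
        ((a Fin.≟ c) ×-dec ((toℕ d ℕ.≟ suc (toℕ b)) ⊎-dec (toℕ b ℕ.≟ suc (toℕ d))))
    ⊎-dec ((b Fin.≟ d) ×-dec (cycSucc? c a ⊎-dec cycSucc? a c))

  mc-∃? : {P : V (MC n k) → Set} → U.Decidable P → Dec (∃ P)
  mc-∃? P? = map′ (λ (a , b , p) → (a , b) , p) (λ ((a , b) , p) → a , b , p)
                  (any? λ a → any? λ b → P? (a , b))

  mc-sym : Symmetric (Adj (MC n k))
  mc-sym (inj₁ (a≡c , inj₁ e)) = inj₁ (sym a≡c , inj₂ e)
  mc-sym (inj₁ (a≡c , inj₂ e)) = inj₁ (sym a≡c , inj₁ e)
  mc-sym (inj₂ (b≡d , inj₁ e)) = inj₂ (sym b≡d , inj₂ e)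
  mc-sym (inj₂ (b≡d , inj₂ e)) = inj₂ (sym b≡d , inj₁ e)

  layer : V (MC n k) → ℕ
  layer (_ , j) = toℕ j

  layer-adj : ∀ {u v} → Adj (MC n k) u v → WithinOne (layer u) (layer v)
  layer-adj (inj₁ (_ , inj₁ d≡1+b)) = ≡suc⇒WithinOne d≡1+b
  layer-adj (inj₁ (_ , inj₂ b≡1+d)) = WithinOne-sym (≡suc⇒WithinOne b≡1+d)
  layer-adj (inj₂ (b≡d , _))         = ≡⇒WithinOne (cong toℕ b≡d)

  layer-oneStep : ∀ {l f} → IsLazyTrack (MC n k) l f → OneStep (layer ∘ f)
  layer-oneStep (_ , steps) {i} {j} i→j with steps i j i→j
  ... | inj₁ adj  = layer-adj adj
  ... | inj₂ fi≡fj = ≡⇒WithinOne (cong layer fi≡fj)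

module _ {N k : ℕ} where

  private
    n : ℕ
    n = suc N

  module _ (b : Fin k) where

    descend : ∀ d {a c : Fin n} → toℕ a ≡ d + toℕ c → Walk (MC n k) (a , b) (c , b) d
    descend zero a≡c with toℕ-injective a≡c
    ... | refl = here
    descend (suc d) {a} {c} a≡1+d+c = step a→a′ (descend d (toℕ-fromℕ< a′<n))
      where
      a′<n : d + toℕ c < n
      a′<n = subst (_≤ n) a≡1+d+c (<⇒≤ (toℕ<n a))
      a→a′ : Adj (MC n k) (a , b) (fromℕ< a′<n , b)
      a→a′ = inj₂ (refl , inj₁ (inj₁ (trans (cong suc (toℕ-fromℕ< a′<n)) (sym a≡1+d+c))))

    wrap-around : Adj (MC n k) (Fin.zero , b) (fromℕ N , b)
    wrap-around = inj₂ (refl , inj₁ (inj₂ (cong suc (toℕ-fromℕ N) , refl)))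

    around : ∀ a c → Walk (MC n k) (c , b) (a , b) (toℕ c + suc (N ∸ toℕ a))
    around a c = descend (toℕ c) (sym (+-identityʳ _))
            ++ᵂ step wrap-around (descend (N ∸ toℕ a) (trans (toℕ-fromℕ N) (sym (m∸n+n≡m a≤N))))
      where
      a≤N : toℕ a ≤ N
      a≤N = ≤-pred (toℕ<n a)

    in-layer-descending : ∀ {a c} → toℕ c ≤ toℕ a →
      ∃ λ m → m ≤ n / 2 × Walk (MC n k) (a , b) (c , b) m
    in-layer-descending {a} {c} c≤a with split-at-half (descent+detour≡1+N c≤a (≤-pred (toℕ<n a)))
    ... | inj₁ short = _ , short , descend _ (sym (m∸n+n≡m c≤a))
    ... | inj₂ short = _ , short , reverse mc-sym (around a c)

    in-layer : ∀ a c → ∃ λ m → m ≤ n / 2 × Walk (MC n k) (a , b) (c , b) m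
    in-layer a c with ≤-total (toℕ c) (toℕ a)
    ... | inj₁ c≤a = in-layer-descending c≤a
    ... | inj₂ a≤c with in-layer-descending a≤c
    ...   | m , short , W = m , short , reverse mc-sym W

  near-layers : ∀ a c {b e : Fin k} → WithinOne (toℕ b) (toℕ e) →
    ∃ λ m → m ≤ suc (n / 2) × Walk (MC n k) (a , b) (c , e) m
  near-layers a c near with in-layer _ a c | WithinOne-cases near
  ... | m , short , W | inj₂ vertical = suc m , s≤s short , step (inj₁ (refl , vertical)) W
  ... | m , short , W | inj₁ b≡e with toℕ-injective b≡e
  ...   | refl = m , m≤n⇒m≤1+n short , W

mc-strong-span : ∀ N K → StrongVertexSpan≤ (MC (suc N) (suc K)) (suc (suc N / 2))
mc-strong-span N K l f g f-lazy@(f-onto , _) g-lazy m min-fg =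
  let j , near         = crossing (layer-oneStep f-lazy) (layer-oneStep g-lazy) starts-below ends-above
      w , w≤bound , W = near-layers (proj₁ (f j)) (proj₁ (g j)) near
  in ≤-trans (minDist≤length min-fg W) w≤bound
  where
  open Distance (MC (suc N) (suc K)) (≡-dec Fin._≟_ Fin._≟_) mc-adj? mc-∃?

  visits : ∀ v → ∃ λ i → f i ≡ v
  visits = surjective⇒strictlySurjective _≡_ refl f-onto

  bottom top : Fin l
  bottom = proj₁ (visits (Fin.zero , Fin.zero))
  top    = proj₁ (visits (Fin.zero , fromℕ K))

  starts-below : layer (f bottom) ≤ layer (g bottom)
  starts-below = subst (_≤ layer (g bottom)) (sym (cong layer (proj₂ (visits _)))) z≤n

  ends-above : layer (g top) ≤ layer (f top)
  ends-above = subst (layer (g top) ≤_) (sym (trans (cong layer (proj₂ (visits _))) (toℕ-fromℕ K)))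
                     (≤-pred (toℕ<n (proj₂ (g top))))

lemma4 : (n k : ℕ) → 3 ≤ n → 2 ≤ k →
    StrongVertexSpan≤ (MC n k) (suc (n / 2)) × DirectVertexSpan≤ (MC n k) (suc (n / 2))
lemma4 (suc N) (suc K) _ _ =
  mc-strong-span N K , strong⇒direct {MC (suc N) (suc K)} (mc-strong-span N K)
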